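{- Let $H^+$ be a reflexive tournament whose initial strongly connected component $H$ has more than one vertex, and let $H_0$ be an endo-trivial subtournament of $H$ with directed Hamilton cycle $HC_0$, $m=|V(H_0)|$. If $\mathrm{Spill}^+_m(H[H_0,HC_0])=V(H)$, then $\mathrm{Spill}^+_m(H^+[H_0,HC_0])=V(H^+)$.
   Context: A reflexive tournament is a digraph with a self-loop at every vertex in which for every two distinct vertices $u,v$ exactly one of $(u,v)$, $(v,u)$ is an edge; a subtournament is an induced subgraph. Its strongly connected components $K_1,\ldots,K_n$ can be ordered so that there is an edge from every vertex of $K_i$ to every vertex of $K_j$ iff $i<j$; $K_1$ is the initial component. A digraph is endo-trivial if each of its endomorphisms is an automorphism or a constant map. Gadget: $DC_m$ is the reflexive directed cycle on $1,\ldots,m$ with edges $(i,i+1)$, $i<m$, and $(m,1)$. $\mathrm{Cyl}_m$ has vertices $(i,j)$, $i,j\in[m]$, all with loops; each $j$-th copy $\{(\cdot,j)\}$ is a copy of $DC_m$; for $j<m$ there are edges $(i,j)\to(i,j+1)$ and $(i,j+1)\to(i',j)$ with $i'=i+1$ if $i<m$, $i'=1$ if $i=m$. Copy $1$ is the bottom, copy $m$ the top. $\mathrm{Cyl}^+_m$ is $\mathrm{Cyl}_m$ together with one new (looped) vertex $x$ and an edge from one fixed vertex of the top copy to $x$. $\mathrm{Spill}^+$: for a reflexive tournament $K$ and a subtournament $K'$ on $m$ vertices with directed Hamilton cycle $C$ labelled $1,\ldots,m$ in cycle order, $F^+(K',C)$ is the disjoint union of $K$ and $\mathrm{Cyl}^+_m$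 with each $(i,1)$ identified with the vertex labelled $i$ of $C$. $\mathrm{Spill}^+_m(K[K',C])$ is the set of $y\in V(K)$ such that there is a retraction $r$ of $F^+(K',C)$ to $K$ (a homomorphism to $K$ that is the identity on $V(K)$) with $r(x)=y$. -}

module Defs where

open import Data.Nat using (ℕ; zero; suc)
open import Data.Nat.DivMod using (_mod_)
open import Data.Fin using (Fin; toℕ; fromℕ; inject₁)
import Data.Fin as F
open import Data.Bool using (Bool; T)
open import Data.Product using (Σ; ∃; _×_; _,_; proj₁)
open import Data.Sum using (_⊎_; inj₁; inj₂)
open import Data.Unit using (⊤; tt)
open import Relation.Nullary using (¬_)
open import Relation.Binary.PropositionalEquality using (_≡_; _≢_)
open import Relation.Binary.Construct.Closure.ReflexiveTransitive using (Star)

record Digraph : Set₁ where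
  field
    V : Set
    E : V → V → Set
open Digraph public

record IsReflexiveTournament (G : Digraph) : Set where
  field
    loop   : ∀ v → E G v v
    total  : ∀ u v → u ≢ v → E G u v ⊎ E G v u
    asym   : ∀ u v → u ≢ v → ¬ (E G u v × E G v u)

Induced : (G : Digraph) → (V G → Bool) → Digraph
Induced G P = record { V = Σ (V G) (λ v → T (P v)) ; E = λ u v → E G (proj₁ u) (proj₁ v) }

Reach : (G : Digraph) → V G → V G → Set
Reach G = Star (E G)

record IsInitialComponent (G : Digraph) (S : V G → Bool) : Set where
  field
    rep       : V G
    component : ∀ u → (T (S u) → Reach G u rep × Reach G rep u)
                    × (Reach G u rep × Reach G rep u → T (S u))
    initial   : ∀ u w → T (S u) → ¬ T (S w) → E G u w

IsHom : (G H : Digraph) → (V G → V H) → Set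
IsHom G H f = ∀ u v → E G u v → E H (f u) (f v)

IsAutomorphism : (G : Digraph) → (V G → V G) → Set
IsAutomorphism G f = Σ (V G → V G) λ g →
  IsHom G G f × IsHom G G g × (∀ v → g (f v) ≡ v) × (∀ v → f (g v) ≡ v)

IsConstant : (G : Digraph) → (V G → V G) → Set
IsConstant G f = Σ (V G) λ a → ∀ v → f v ≡ a

EndoTrivial : Digraph → Set
EndoTrivial G = ∀ f → IsHom G G f → IsAutomorphism G f ⊎ IsConstant G f

next : ∀ {k} → Fin (suc k) → Fin (suc k)
next {k} i = suc (toℕ i) mod suc k

record IsHamiltonCycle (G : Digraph) {k : ℕ} (c : Fin (suc k) → V G) : Set where
  field
    injective  : ∀ i j → c i ≡ c j → i ≡ j
    surjective : ∀ v → ∃ λ i → c i ≡ v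
    edges      : ∀ i → E G (c i) (c (next i))

-- Vertices: V(K), the cylinder vertices
-- (i,j) of copies 2..m (copy index j : Fin k stands for copy j+2), and x.
-- The bottom copy vertex (i,1) is identified with c i.
FV : Digraph → ℕ → Set
FV K k = V K ⊎ ((Fin (suc k) × Fin k) ⊎ ⊤)

xF : ∀ {K k} → FV K k
xF = inj₂ (inj₂ tt)

cyl : ∀ {K k} → (Fin (suc k) → V K) → Fin (suc k) → Fin (suc k) → FV K k
cyl c i F.zero    = inj₁ (c i)
cyl c i (F.suc j) = inj₂ (inj₁ (i , j))

data FE (K : Digraph) {k : ℕ} (c : Fin (suc k) → V K) (i₀ : Fin (suc k))
        : FV K k → FV K k → Set where
  loopF : ∀ w → FE K c i₀ w w
  base  : ∀ u v → E K u v → FE K c i₀ (inj₁ u) (inj₁ v)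
  cycE  : ∀ i j → FE K c i₀ (cyl {K} c i j) (cyl {K} c (next i) j)
  upE   : ∀ i (j : Fin k) → FE K c i₀ (cyl {K} c i (inject₁ j)) (cyl {K} c i (F.suc j))
  downE : ∀ i (j : Fin k) → FE K c i₀ (cyl {K} c i (F.suc j)) (cyl {K} c (next i) (inject₁ j))
  toX   : FE K c i₀ (cyl {K} c i₀ (fromℕ k)) (xF {K} {k})

F⁺ : (K : Digraph) {k : ℕ} → (Fin (suc k) → V K) → Fin (suc k) → Digraph
F⁺ K {k} c i₀ = record { V = FV K k ; E = FE K c i₀ }

Spill⁺ : (K : Digraph) {k : ℕ} → (Fin (suc k) → V K) → Fin (suc k) → V K → Set
Spill⁺ K {k} c i₀ y = Σ (FV K k → V K) λ r →
  IsHom (F⁺ K c i₀) K r × (∀ v → r (inj₁ v) ≡ v) × (r (xF {K} {k}) ≡ y)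

FinDigraph : (n : ℕ) → (Fin n → Fin n → Set) → Digraph
FinDigraph n E' = record { V = Fin n ; E = E' }

-- A retraction r′ of the gadget onto the initial component H, followed by the
-- inclusion H ⊆ H⁺, is already a homomorphism into H⁺ on everything but x, and
-- x may then be sent to any out-neighbour t of the image a of the top vertex
-- joined to x.  For t ∈ H take r′ with r′ x = t, so a → t is the image of the
-- edge into x; for t ∉ H any r′ will do, since H is initial and a ∈ H.
module Submission where

open import Defs
open import Data.Nat using (ℕ; suc)
open import Data.Fin using (Fin; fromℕ)
import Data.Fin as F
open import Data.Bool using (Bool; T)
open import Data.Bool.Properties using (T?)
open import Data.Product using (Σ; _×_; _,_; proj₁; proj₂)
open import Data.Sum using (inj₁; inj₂)
open import Data.Unit using (tt)
open import Function using (_∘_)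
open import Relation.Nullary using (yes; no)
open import Relation.Binary.PropositionalEquality using (_≡_; _≢_; refl; sym; cong; subst; subst₂)

IsRetraction : (K : Digraph) {k : ℕ} (c : Fin (suc k) → V K) (i₀ : Fin (suc k))
  → (FV K k → V K) → Set
IsRetraction K c i₀ r = IsHom (F⁺ K c i₀) K r × (∀ v → r (inj₁ v) ≡ v)

top : (K : Digraph) {k : ℕ} → (Fin (suc k) → V K) → Fin (suc k) → FV K k
top K {k} c i₀ = cyl {K} c i₀ (fromℕ k)

spill⁺-at-top-successor : (K L : Digraph) {k : ℕ}
  (f : V K → V L) → IsHom K L f → (∀ v → E L v v)
  → (c : Fin (suc k) → V K) (i₀ : Fin (suc k))
  → (r′ : FV K k → V K) → IsRetraction K c i₀ r′
  → ∀ t → E L (f (r′ (top K c i₀))) t → Spill⁺ L (f ∘ c) i₀ t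
spill⁺-at-top-successor K L {k} f f-hom loop c i₀ r′ (r′-hom , r′-ret) t top→t =
  r , r-hom , (λ _ → refl) , refl
  where
  r : FV L k → V L
  r (inj₁ v)          = v
  r (inj₂ (inj₁ p))   = f (r′ (inj₂ (inj₁ p)))
  r (inj₂ (inj₂ tt))  = t

  r-cyl : ∀ i j → r (cyl {L} (f ∘ c) i j) ≡ f (r′ (cyl {K} c i j))
  r-cyl i F.zero    = sym (cong f (r′-ret (c i)))
  r-cyl i (F.suc j) = refl

  along : ∀ {i j i′ j′} → FE K c i₀ (cyl {K} c i j) (cyl {K} c i′ j′)
    → E L (r (cyl {L} (f ∘ c) i j)) (r (cyl {L} (f ∘ c) i′ j′))
  along {i} {j} {i′} {j′} e =
    subst₂ (E L) (sym (r-cyl i j)) (sym (r-cyl i′ j′)) (f-hom _ _ (r′-hom _ _ e))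

  r-hom : IsHom (F⁺ L (f ∘ c) i₀) L r
  r-hom _ _ (loopF w)     = loop (r w)
  r-hom _ _ (base u v e)  = e
  r-hom _ _ (cycE i j)    = along (cycE i j)
  r-hom _ _ (upE i j)     = along (upE i j)
  r-hom _ _ (downE i j)   = along (downE i j)
  r-hom _ _ toX           = subst (λ a → E L a t) (sym (r-cyl i₀ (fromℕ k))) top→t

spill⁺-into-supergraph : (G : Digraph) → (∀ v → E G v v) → (P : V G → Bool)
  → {k : ℕ} (c : Fin (suc k) → V (Induced G P)) (i₀ : Fin (suc k))
  → (r′ : FV (Induced G P) k → V (Induced G P)) → IsRetraction (Induced G P) c i₀ r′
  → ∀ t → E G (proj₁ (r′ (top (Induced G P) c i₀))) t → Spill⁺ G (proj₁ ∘ c) i₀ t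
spill⁺-into-supergraph G loop P = spill⁺-at-top-successor (Induced G P) G proj₁ (λ _ _ e → e) loop

lemma3p10 : (n : ℕ) (E⁺ : Fin n → Fin n → Set)
    → IsReflexiveTournament (FinDigraph n E⁺)
    → (inH : Fin n → Bool) → IsInitialComponent (FinDigraph n E⁺) inH
    → Σ (Fin n) (λ u → Σ (Fin n) (λ v → T (inH u) × T (inH v) × u ≢ v))
    → (P₀ : V (Induced (FinDigraph n E⁺) inH) → Bool)
    → EndoTrivial (Induced (Induced (FinDigraph n E⁺) inH) P₀)
    → (k : ℕ) (c : Fin (suc k) → V (Induced (Induced (FinDigraph n E⁺) inH) P₀))
    → IsHamiltonCycle (Induced (Induced (FinDigraph n E⁺) inH) P₀) c
    → (i₀ : Fin (suc k))
    → (∀ y → Spill⁺ (Induced (FinDigraph n E⁺) inH) (λ i → proj₁ (c i)) i₀ y)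
    → (∀ y → Spill⁺ (FinDigraph n E⁺) (λ i → proj₁ (proj₁ (c i))) i₀ y)
lemma3p10 n E⁺ tour inH initial (u , _ , u∈H , _) _ _ k c _ i₀ spillH y
  with T? (inH y)
... | yes y∈H =
  let r′ , r′-hom , r′-ret , r′x≡y = spillH (y , y∈H)
  in spill⁺-into-supergraph (FinDigraph n E⁺) (IsReflexiveTournament.loop tour)
       inH (proj₁ ∘ c) i₀ r′ (r′-hom , r′-ret) y
       (subst (E⁺ _) (cong proj₁ r′x≡y) (r′-hom _ _ toX))
... | no y∉H =
  let r′ , r′-hom , r′-ret , _ = spillH (u , u∈H)
  in spill⁺-into-supergraph (FinDigraph n E⁺) (IsReflexiveTournament.loop tour)
       inH (proj₁ ∘ c) i₀ r′ (r′-hom , r′-ret) y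
       (IsInitialComponent.initial initial _ y (proj₂ (r′ _)) y∉H)
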